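{- Let $b=(B_1,\dots,B_k)$ be a bonsai sequence on $[n]$ of type $(t_1,\dots,t_k)$. The number of rooted forests on $[n]$ whose bonsai sequence is $b$ equals \[ (t_1+1)(t_1+t_2+1)\cdots(t_1+t_2+\cdots+t_{k-1}+1). \]
   Context: A bonsai is a rooted labelled tree whose root has the largest label. A bonsai sequence on $[n]=\{1,\dots,n\}$ is a sequence $(B_1,\dots,B_k)$ of bonsais with pairwise disjoint label sets whose union is $[n]$, ordered by increasing root label, with the property that for each $i$ the root of $B_i$ is larger than every label of $B_1,\dots,B_{i-1}$; its type is $(|B_1|,\dots,|B_k|)$. A rooted forest on $[n]$ is a set of rooted labelled trees with disjoint vertex sets whose union is $[n]$; a vertex is a record if its label is the largest on the path from it to the root of its tree (inclusive). The bonsai sequence of a rooted forest is obtained by deleting every edge joining a record to its parent, which yields bonsais rooted at the records, and ordering them by increasing root label. -}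

module Defs where

open import Data.Nat using (ℕ; zero; suc; _+_; _*_; _≤ᵇ_)
open import Data.Bool using (Bool; true; false; _∧_; if_then_else_)
import Data.Bool
open import Data.Maybe using (Maybe; just; nothing)
open import Data.Fin using (Fin; toℕ; _≤_; _<_; _≟_)
open import Data.Vec using (Vec; lookup; tabulate; allFin)
open import Data.Vec.Relation.Unary.All using (All)
open import Data.List using (List; []; _∷_; map; length; filter)
open import Data.Product using (_×_)
open import Relation.Binary.PropositionalEquality using (_≡_)
import Data.Vec as V
open import Data.Maybe using (is-nothing)
open import Relation.Nullary.Decidable using (does)

-- A "parent vector" on the vertex set [n] (encoded as Fin n, label i+1 ↔ i):
-- entry v is  nothing  if v is a root, and  just u  if u is the parent of v.
Parent : ℕ → Set
Parent n = Vec (Maybe (Fin n)) n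

anc : ∀ {n} → Parent n → ℕ → Fin n → Maybe (Fin n)
anc p zero    v = just v
anc p (suc k) v with lookup p v
... | nothing = nothing
... | just u  = anc p k u

-- p describes a rooted forest on [n] iff there are no cycles, i.e. every
-- vertex has no n-th ancestor (a path in an acyclic structure on n
-- vertices has at most n - 1 edges).
IsForest : ∀ {n} → Parent n → Set
IsForest {n} p = All (λ v → anc p n v ≡ nothing) (allFin n)

-- root of the tree containing v (fuel n suffices on a forest)
rootF : ∀ {n} → Parent n → ℕ → Fin n → Fin n
rootF p zero    v = v
rootF p (suc k) v with lookup p v
... | nothing = v
... | just u  = rootF p k u

root : ∀ {n} → Parent n → Fin n → Fin n
root {n} p v = rootF p n v

recF : ∀ {n} → Parent n → ℕ → Fin n → Fin n → Bool
recF p zero    v w = true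
recF p (suc k) v w with lookup p w
... | nothing = true
... | just u  = (toℕ u ≤ᵇ toℕ v) ∧ recF p k v u

-- v is a record: its label is the largest on the path from v to the root.
isRecord : ∀ {n} → Parent n → Fin n → Bool
isRecord {n} p v = recF p n v v

-- The bonsai sequence of a forest: delete every edge joining a record to
-- its parent.  (Bonsais ordered by increasing root label; the order is
-- determined by the labels, so the set of trees, i.e. the parent vector,
-- determines the sequence.)
bonsaiSeq : ∀ {n} → Parent n → Parent n
bonsaiSeq p = tabulate (λ v → if isRecord p v then nothing else lookup p v)

IsBonsaiSeq : ∀ {n} → Parent n → Set
IsBonsaiSeq q =
  IsForest q
  × (∀ v → v ≤ root q v)
  × (∀ u v → root q u < root q v → u < root q v)

rootsOf : ∀ {n} → Parent n → List (Fin n)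
rootsOf {n} q = filter (λ v → is-nothing (lookup q v) Data.Bool.≟ true) (V.toList (allFin n))

bonsaiType : ∀ {n} → Parent n → List ℕ
bonsaiType {n} q =
  map (λ r → length (filter (λ v → root q v ≟ r) (V.toList (allFin n)))) (rootsOf q)

-- prefixProduct acc (t_1,…,t_k) = (acc+t_1+1)(acc+t_1+t_2+1)⋯(acc+t_1+⋯+t_{k-1}+1)
prefixProduct : ℕ → List ℕ → ℕ
prefixProduct acc []             = 1
prefixProduct acc (t ∷ [])       = 1
prefixProduct acc (t ∷ t' ∷ ts)  = suc (acc + t) * prefixProduct (acc + t) (t' ∷ ts)

typeProduct : List ℕ → ℕ
typeProduct ts = prefixProduct 0 ts

-- Let ρ(w) be the root of the bonsai of b containing w. A forest p has bonsai sequence b exactly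
-- when every non-root v of b keeps its parent from b, and every root v of b is either a root of p
-- or is attached to some w with ρ(w) < v. Indeed, along a path of such a p the bonsai root can only
-- decrease, and strictly so when the path leaves b; as labels are bounded by their bonsai roots,
-- this makes p acyclic, makes the roots of b records and the other vertices non-records.
-- Parents are then chosen independently: the root of the i-th bonsai has 1 + t₁ + ⋯ + tᵢ₋₁ choices
-- and every other vertex has one.
module Submission where

open import Defs
open import Data.Nat using (ℕ; zero; suc; _+_; _*_; _∸_; z≤n; s≤s)
import Data.Nat as ℕ
import Data.Nat.Properties as ℕ
open import Data.Nat.ListAction using (product)
open import Data.Bool using (true; false; T; if_then_else_)
import Data.Bool as Bool
open import Data.Bool.Properties using (T-∧)
open import Data.Maybe using (Maybe; just; nothing; is-nothing; _>>=_; fromMaybe)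
open import Data.Maybe.Properties using (just-injective)
open import Data.Fin using (Fin; zero; suc; toℕ; _≤_; _<_; _≟_)
open import Data.Fin.Properties
  using (1↔⊤; +↔⊎; *↔×; pigeonhole; toℕ≤pred[n]; toℕ-injective; ≤∧≢⇒<)
open import Data.Vec using (Vec; []; _∷_; lookup; tabulate; allFin; toList)
open import Data.Vec.Properties using (lookup∘tabulate; tabulate∘lookup; tabulate-cong)
import Data.Vec.Relation.Unary.All as All
open import Data.Vec.Relation.Unary.All.Properties using ()
  renaming (tabulate⁺ to All-tabulate⁺; tabulate⁻ to All-tabulate⁻)
open import Data.Vec.Relation.Binary.Pointwise.Inductive using (Pointwise; []; _∷_)
open import Data.List using (List; []; _∷_; map; length; filter)
import Data.List.Relation.Unary.All as ListAll
open import Data.List.Properties using (filter-none)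
open import Data.Product using (Σ; ∃; ∃₂; _×_; _,_; proj₁; proj₂)
open import Data.Sum using (_⊎_; inj₁; inj₂; [_,_])
open import Data.Empty using (⊥; ⊥-elim)
open import Data.Unit using (⊤; tt)
open import Function using (id; _∘_)
open import Function.Bundles using (_↔_; _⇔_; mk↔ₛ′; mk⇔; Equivalence)
open import Function.Properties.Inverse using (↔-trans; ↔-sym)
open import Data.Product.Function.NonDependent.Propositional using (_×-↔_)
open import Data.Sum.Function.Propositional using (_⊎-↔_)
open import Level using (0ℓ)
open import Axiom.UniquenessOfIdentityProofs.WithK using (uip)
open import Relation.Binary.PropositionalEquality
  using (_≡_; _≢_; refl; sym; trans; cong; cong₂; subst; module ≡-Reasoning)
open import Relation.Nullary using (¬_; Dec; yes; no; contradiction)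
import Relation.Nullary as Nullary
open import Relation.Unary using (Pred; Decidable; Irrelevant)
import Relation.Binary as Binary

open ≡-Reasoning

-- Counting by bijections with Fin

Σ-Fin-suc-↔ : ∀ {k} (P : Fin (suc k) → Set) →
  Σ (Fin (suc k)) P ↔ (P zero ⊎ Σ (Fin k) (P ∘ suc))
Σ-Fin-suc-↔ P = mk↔ₛ′
  (λ { (zero , x) → inj₁ x ; (suc i , x) → inj₂ (i , x) })
  (λ { (inj₁ x) → zero , x ; (inj₂ (i , x)) → suc i , x })
  (λ { (inj₁ _) → refl ; (inj₂ _) → refl })
  (λ { (zero , _) → refl ; (suc _ , _) → refl })

Σ-Maybe-↔ : ∀ {A : Set} (P : Maybe A → Set) →
  Σ (Maybe A) P ↔ (P nothing ⊎ Σ A (P ∘ just))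
Σ-Maybe-↔ P = mk↔ₛ′
  (λ { (nothing , x) → inj₁ x ; (just a , x) → inj₂ (a , x) })
  (λ { (inj₁ x) → nothing , x ; (inj₂ (a , x)) → just a , x })
  (λ { (inj₁ _) → refl ; (inj₂ _) → refl })
  (λ { (nothing , _) → refl ; (just _ , _) → refl })

Σ-singleton-↔ : ∀ {A : Set} (a : A) → Σ A (_≡ a) ↔ Fin 1
Σ-singleton-↔ a =
  mk↔ₛ′ (λ _ → zero) (λ _ → a , refl) (λ { zero → refl }) (λ { (_ , refl) → refl })

irrelevant-↔-Fin1 : ∀ {A : Set} → Nullary.Irrelevant A → A → A ↔ Fin 1
irrelevant-↔-Fin1 A-irr a = mk↔ₛ′ (λ _ → zero) (λ _ → a) (λ { zero → refl }) (A-irr a)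

empty-↔-Fin0 : ∀ {A : Set} → ¬ A → A ↔ Fin 0
empty-↔-Fin0 ¬a =
  mk↔ₛ′ (λ a → contradiction a ¬a) (λ ()) (λ ()) (λ a → contradiction a ¬a)

Σ-↔-length-filter : ∀ {A : Set} {P : Pred A 0ℓ} → Irrelevant P → (P? : Decidable P) →
  ∀ {k} (f : Fin k → A) → Σ (Fin k) (P ∘ f) ↔ Fin (length (filter P? (toList (tabulate f))))
Σ-↔-length-filter P-irr P? {zero} f = mk↔ₛ′ (λ ()) (λ ()) (λ ()) (λ ())
Σ-↔-length-filter P-irr P? {suc k} f with P? (f zero)
... | yes p = ↔-trans (Σ-Fin-suc-↔ _)
  (↔-trans (irrelevant-↔-Fin1 P-irr p ⊎-↔ Σ-↔-length-filter P-irr P? (f ∘ suc))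
           (↔-sym +↔⊎))
... | no ¬p = ↔-trans (Σ-Fin-suc-↔ _)
  (↔-trans (empty-↔-Fin0 ¬p ⊎-↔ Σ-↔-length-filter P-irr P? (f ∘ suc)) (↔-sym +↔⊎))

Σ-Pointwise-∷-↔ : ∀ {X A : Set} {R : X → A → Set} {k x} {xs : Vec X k} →
  Σ (Vec A (suc k)) (Pointwise R (x ∷ xs)) ↔ (Σ A (R x) × Σ (Vec A k) (Pointwise R xs))
Σ-Pointwise-∷-↔ = mk↔ₛ′
  (λ { (a ∷ as , r ∷ rs) → (a , r) , (as , rs) })
  (λ { ((a , r) , (as , rs)) → a ∷ as , r ∷ rs })
  (λ _ → refl)
  (λ { (_ ∷ _ , _ ∷ _) → refl })

Σ-Pointwise-↔ : ∀ {X A : Set} {R : X → A → Set} (size : X → ℕ) →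
  (∀ x → Σ A (R x) ↔ Fin (size x)) → ∀ {k} (xs : Vec X k) →
  Σ (Vec A k) (Pointwise R xs) ↔ Fin (product (map size (toList xs)))
Σ-Pointwise-↔ size count [] =
  mk↔ₛ′ (λ _ → zero) (λ _ → [] , []) (λ { zero → refl }) (λ { ([] , []) → refl })
Σ-Pointwise-↔ size count (x ∷ xs) =
  ↔-trans Σ-Pointwise-∷-↔ (↔-trans (count x ×-↔ Σ-Pointwise-↔ size count xs) (↔-sym *↔×))

Σ-cong-⇔ : ∀ {A : Set} {P Q : Pred A 0ℓ} → Irrelevant P → Irrelevant Q →
  (∀ x → P x ⇔ Q x) → Σ A P ↔ Σ A Q
Σ-cong-⇔ P-irr Q-irr P⇔Q = mk↔ₛ′
  (λ (x , px) → x , Equivalence.to (P⇔Q x) px)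
  (λ (x , qx) → x , Equivalence.from (P⇔Q x) qx)
  (λ (x , _) → cong (x ,_) (Q-irr _ _))
  (λ (x , _) → cong (x ,_) (P-irr _ _))

Pointwise-irrelevant : ∀ {X A : Set} {R : X → A → Set} → Binary.Irrelevant R →
  ∀ {k} {xs : Vec X k} {as : Vec A k} → Nullary.Irrelevant (Pointwise R xs as)
Pointwise-irrelevant R-irr [] [] = refl
Pointwise-irrelevant R-irr (r ∷ rs) (r′ ∷ rs′) =
  cong₂ _∷_ (R-irr r r′) (Pointwise-irrelevant R-irr rs rs′)

Pointwise-tabulate⁻ : ∀ {X A : Set} {R : X → A → Set} {k} {f : Fin k → X} {as : Vec A k} →
  Pointwise R (tabulate f) as → ∀ i → R (f i) (lookup as i)
Pointwise-tabulate⁻ (r ∷ rs) zero    = r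
Pointwise-tabulate⁻ (r ∷ rs) (suc i) = Pointwise-tabulate⁻ rs i

Pointwise-tabulate⁺ : ∀ {X A : Set} {R : X → A → Set} {k} {f : Fin k → X} (as : Vec A k) →
  (∀ i → R (f i) (lookup as i)) → Pointwise R (tabulate f) as
Pointwise-tabulate⁺ []       rs = []
Pointwise-tabulate⁺ (a ∷ as) rs = rs zero ∷ Pointwise-tabulate⁺ as (rs ∘ suc)

length-filter-⊎ : ∀ {A : Set} {P Q R : Pred A 0ℓ}
  (P? : Decidable P) (Q? : Decidable Q) (R? : Decidable R) →
  (∀ {x} → P x ⇔ (Q x ⊎ R x)) → (∀ {x} → Q x → ¬ R x) →
  ∀ xs → length (filter P? xs) ≡ length (filter Q? xs) + length (filter R? xs)
length-filter-⊎ P? Q? R? P⇔Q⊎R disjoint [] = refl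
length-filter-⊎ P? Q? R? P⇔Q⊎R disjoint (x ∷ xs)
  with ih ← length-filter-⊎ P? Q? R? P⇔Q⊎R disjoint xs | P? x | Q? x | R? x
... | _     | yes q | yes r = contradiction r (disjoint q)
... | yes _ | yes _ | no _  = cong suc ih
... | yes _ | no _  | yes _ = trans (cong suc ih) (sym (ℕ.+-suc _ _))
... | yes p | no ¬q | no ¬r = ⊥-elim ([ ¬q , ¬r ] (Equivalence.to P⇔Q⊎R p))
... | no ¬p | yes q | no _  = contradiction (Equivalence.from P⇔Q⊎R (inj₁ q)) ¬p
... | no ¬p | no _  | yes r = contradiction (Equivalence.from P⇔Q⊎R (inj₂ r)) ¬p
... | no _  | no _  | no _  = ih

-- Ancestors in a parent vector

module _ {n : ℕ} (p : Parent n) where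

  anc-parent : ∀ {k x u} → lookup p x ≡ just u → anc p (suc k) x ≡ anc p k u
  anc-parent px rewrite px = refl

  anc-+ : ∀ j k x → anc p (j + k) x ≡ (anc p j x >>= anc p k)
  anc-+ zero    k x = refl
  anc-+ (suc j) k x with lookup p x
  ... | nothing = refl
  ... | just u  = anc-+ j k u

  anc-mono : ∀ {j k} x → j ℕ.≤ k → anc p j x ≡ nothing → anc p k x ≡ nothing
  anc-mono x z≤n       ()
  anc-mono x (s≤s j≤k) h with lookup p x
  ... | nothing = refl
  ... | just u  = anc-mono u j≤k h

  anc-just⇒< : ∀ {k x y} → anc p n x ≡ nothing → anc p k x ≡ just y → k ℕ.< n
  anc-just⇒< {x = x} forest a =
    ℕ.≰⇒> λ n≤k → contradiction (trans (sym a) (anc-mono x n≤k forest)) λ ()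

  Acyclic : Set
  Acyclic = ∀ d x → anc p (suc d) x ≢ just x

  anc-cycle : ∀ {d x} → anc p (suc d) x ≡ just x → ∀ m → anc p (m * suc d) x ≡ just x
  anc-cycle         cycle zero    = refl
  anc-cycle {d} {x} cycle (suc m) = begin
    anc p (suc d + m * suc d) x              ≡⟨ anc-+ (suc d) (m * suc d) x ⟩
    (anc p (suc d) x >>= anc p (m * suc d))  ≡⟨ cong (_>>= anc p (m * suc d)) cycle ⟩
    anc p (m * suc d) x                      ≡⟨ anc-cycle cycle m ⟩
    just x                                   ∎

  forest⇒acyclic : (∀ v → anc p n v ≡ nothing) → Acyclic
  forest⇒acyclic forest d x cycle =
    contradiction (trans (sym (anc-cycle cycle n)) (anc-mono x (ℕ.m≤m*n n (suc d)) (forest x))) λ ()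

  -- Among the n + 1 ancestors of v at distances 0, …, n two coincide, which closes a cycle.
  acyclic⇒forest : Acyclic → ∀ v → anc p n v ≡ nothing
  acyclic⇒forest acyclic v with anc p n v in anc-n
  ... | nothing = refl
  ... | just _  = ⊥-elim (repeated-ancestor (pigeonhole (ℕ.n<1+n n) ancestorAt))
    where
    ancestorAt : Fin (suc n) → Fin n
    ancestorAt i = fromMaybe v (anc p (toℕ i) v)

    anc-ancestorAt : ∀ i → anc p (toℕ i) v ≡ just (ancestorAt i)
    anc-ancestorAt i with anc p (toℕ i) v in anc-i
    ... | just _  = refl
    ... | nothing = contradiction (trans (sym anc-n) (anc-mono v (toℕ≤pred[n] i) anc-i)) λ ()

    repeated-ancestor : ∃₂ (λ i j → i < j × ancestorAt i ≡ ancestorAt j) → ⊥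
    repeated-ancestor (i , j , i<j , same) = acyclic d y (begin
      anc p (suc d) y                   ≡⟨ cong (_>>= anc p (suc d)) (anc-ancestorAt i) ⟨
      (anc p (toℕ i) v >>= anc p (suc d)) ≡⟨ anc-+ (toℕ i) (suc d) v ⟨
      anc p (toℕ i + suc d) v           ≡⟨ cong (λ m → anc p m v) i+suc[d]≡j ⟩
      anc p (toℕ j) v                   ≡⟨ anc-ancestorAt j ⟩
      just (ancestorAt j)               ≡⟨ cong just same ⟨
      just y                            ∎)
      where
      y : Fin n
      y = ancestorAt i
      d : ℕ
      d = toℕ j ∸ suc (toℕ i)
      i+suc[d]≡j : toℕ i + suc d ≡ toℕ j
      i+suc[d]≡j = trans (ℕ.+-suc (toℕ i) d) (ℕ.m+[n∸m]≡n i<j)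

  rootF-of-root : ∀ k {x} → lookup p x ≡ nothing → rootF p k x ≡ x
  rootF-of-root zero    px = refl
  rootF-of-root (suc k) px rewrite px = refl

  rootF-ancestor : ∀ k x → ∃ λ d → d ℕ.≤ k × anc p d x ≡ just (rootF p k x)
  rootF-ancestor zero    x = 0 , z≤n , refl
  rootF-ancestor (suc k) x with lookup p x in px
  ... | nothing = 0 , z≤n , refl
  ... | just u with rootF-ancestor k u
  ...   | d , d≤k , a = suc d , s≤s d≤k , trans (anc-parent px) a

  rootF-isRoot : ∀ k x → anc p k x ≡ nothing → lookup p (rootF p k x) ≡ nothing
  rootF-isRoot zero    x ()
  rootF-isRoot (suc k) x h with lookup p x in px
  ... | nothing = px
  ... | just u  = rootF-isRoot k u h

  rootF-suc : ∀ k x → anc p k x ≡ nothing → rootF p k x ≡ rootF p (suc k) x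
  rootF-suc zero    x ()
  rootF-suc (suc k) x h with lookup p x
  ... | nothing = refl
  ... | just u  = rootF-suc k u h

  rootF-parent : ∀ k {x u} → lookup p x ≡ just u → anc p k x ≡ nothing →
    rootF p k x ≡ rootF p k u
  rootF-parent zero    px ()
  rootF-parent (suc k) {x} {u} px h rewrite px = rootF-suc k u h

  recF-sound : ∀ k v w j {x} → T (recF p k v w) → j ℕ.< k →
    anc p (suc j) w ≡ just x → x ≤ v
  recF-sound (suc k) v w j rec (s≤s j≤k) a with lookup p w
  recF-sound (suc k) v w j       rec _         () | nothing
  recF-sound (suc k) v w zero    rec _         refl | just u =
    ℕ.≤ᵇ⇒≤ _ _ (proj₁ (Equivalence.to T-∧ rec))
  recF-sound (suc k) v w (suc j) rec (s≤s j≤k) a    | just u =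
    recF-sound k v u j (proj₂ (Equivalence.to T-∧ rec)) j≤k a

  recF-complete : ∀ k v w → (∀ j {x} → anc p (suc j) w ≡ just x → x ≤ v) →
    T (recF p k v w)
  recF-complete zero    v w above = tt
  recF-complete (suc k) v w above with lookup p w
  ... | nothing = tt
  ... | just u  =
    Equivalence.from T-∧ (ℕ.≤⇒≤ᵇ (above 0 refl) , recF-complete k v u (above ∘ suc))

anc-⊆ : ∀ {n} {q p : Parent n} →
  (∀ {x y} → lookup q x ≡ just y → lookup p x ≡ just y) →
  ∀ k {x y} → anc q k x ≡ just y → anc p k x ≡ just y
anc-⊆ q⊆p zero a = a
anc-⊆ {q = q} {p} q⊆p (suc k) {x} a with lookup q x in qx
... | nothing = contradiction a λ ()
... | just u  = trans (anc-parent p (q⊆p qx)) (anc-⊆ q⊆p k a)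

-- Forests with a prescribed bonsai sequence

-- prefixProduct′ acc ts also has the leading factor acc + 1, which prefixProduct omits.
prefixProduct′ : ℕ → List ℕ → ℕ
prefixProduct′ acc []       = 1
prefixProduct′ acc (t ∷ ts) = suc acc * prefixProduct′ (acc + t) ts

prefixProduct-∷ : ∀ acc t ts → prefixProduct acc (t ∷ ts) ≡ prefixProduct′ (acc + t) ts
prefixProduct-∷ acc t []        = refl
prefixProduct-∷ acc t (t′ ∷ ts) = cong (suc (acc + t) *_) (prefixProduct-∷ (acc + t) t′ ts)

typeProduct≡prefixProduct′ : ∀ ts → typeProduct ts ≡ prefixProduct′ 0 ts
typeProduct≡prefixProduct′ []       = refl
typeProduct≡prefixProduct′ (t ∷ ts) = trans (prefixProduct-∷ 0 t ts) (sym (ℕ.+-identityʳ _))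

Consecutive : ∀ {n k} → ℕ → (Fin k → Fin n) → Set
Consecutive m f = ∀ i → toℕ (f i) ≡ m + toℕ i

consecutive-head : ∀ {n k m} {f : Fin (suc k) → Fin n} → Consecutive m f → toℕ (f zero) ≡ m
consecutive-head {m = m} f-consecutive = trans (f-consecutive zero) (ℕ.+-identityʳ m)

consecutive-tail : ∀ {n k m} {f : Fin (suc k) → Fin n} →
  Consecutive m f → Consecutive (suc m) (f ∘ suc)
consecutive-tail {m = m} f-consecutive i = trans (f-consecutive (suc i)) (ℕ.+-suc m (toℕ i))

module BonsaiForest {n : ℕ} (b : Parent n)
  (b-forest : ∀ v → anc b n v ≡ nothing) (≤-root : ∀ v → v ≤ root b v) where

  root-isRoot : ∀ v → lookup b (root b v) ≡ nothing
  root-isRoot v = rootF-isRoot b n v (b-forest v)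

  root-of-root : ∀ {v} → lookup b v ≡ nothing → root b v ≡ v
  root-of-root = rootF-of-root b n

  root-parent : ∀ {v u} → lookup b v ≡ just u → root b v ≡ root b u
  root-parent {v} bv = rootF-parent b n bv (b-forest v)

  root-anc : ∀ k {x y} → anc b k x ≡ just y → root b y ≡ root b x
  root-anc zero    refl = refl
  root-anc (suc k) {x} a with lookup b x in bx
  ... | nothing = contradiction a λ ()
  ... | just u  = trans (root-anc k a) (sym (root-parent bx))

  root-≢-nonroot : ∀ {r u} → lookup b r ≡ just u → ∀ w → root b w ≢ r
  root-≢-nonroot br w ρw≡r =
    contradiction (trans (sym br) (subst (λ x → lookup b x ≡ nothing) ρw≡r (root-isRoot w))) λ ()

  nonroot-<-root : ∀ {v u} → lookup b v ≡ just u → v < root b v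
  nonroot-<-root {v} bv = ≤∧≢⇒< (≤-root v) (root-≢-nonroot bv v ∘ sym)

  -- AdmissibleFor (lookup b v) v a: a may be the parent of v in a forest whose bonsai sequence is b.
  AdmissibleFor : Maybe (Fin n) → Fin n → Maybe (Fin n) → Set
  AdmissibleFor (just u) v a        = a ≡ just u
  AdmissibleFor nothing  v nothing  = ⊤
  AdmissibleFor nothing  v (just w) = root b w < v

  Admissible : Fin n → Maybe (Fin n) → Set
  Admissible v = AdmissibleFor (lookup b v) v

  admissible-irrelevant : Binary.Irrelevant Admissible
  admissible-irrelevant {v} {a} = irrelevant (lookup b v) a
    where
    irrelevant : ∀ c a → Nullary.Irrelevant (AdmissibleFor c v a)
    irrelevant (just _) _        = uip
    irrelevant nothing  nothing  = λ _ _ → refl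
    irrelevant nothing  (just w) = ℕ.<-irrelevant

  module Forest⇒Admissible
    (p : Parent n) (p-forest : ∀ v → anc p n v ≡ nothing) (p↦b : bonsaiSeq p ≡ b) where

    bonsaiSeq-lookup : ∀ v → lookup b v ≡ (if isRecord p v then nothing else lookup p v)
    bonsaiSeq-lookup v = trans (cong (λ q → lookup q v) (sym p↦b)) (lookup∘tabulate _ v)

    bonsaiEdge⇒edge : ∀ {x y} → lookup b x ≡ just y → lookup p x ≡ just y
    bonsaiEdge⇒edge {x} bx with isRecord p x | bonsaiSeq-lookup x
    ... | true  | b≡ = contradiction (trans (sym bx) b≡) λ ()
    ... | false | b≡ = trans (sym b≡) bx

    bonsaiRoot-isRecord : ∀ {v u} → lookup b v ≡ nothing → lookup p v ≡ just u →
      T (isRecord p v)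
    bonsaiRoot-isRecord {v} bv pv with isRecord p v | bonsaiSeq-lookup v
    ... | true  | _  = tt
    ... | false | b≡ = contradiction (trans (sym bv) (trans b≡ pv)) λ ()

    -- The bonsai root of u is a p-ancestor of the record v, and it is not v itself as p is acyclic.
    graft-below : ∀ {v u} → lookup b v ≡ nothing → lookup p v ≡ just u → root b u < v
    graft-below {v} {u} bv pv with rootF-ancestor b n u
    ... | d , _ , anc-b = ≤∧≢⇒< ρu≤v ρu≢v
      where
      anc-p : anc p (suc d) v ≡ just (root b u)
      anc-p = trans (anc-parent p pv) (anc-⊆ bonsaiEdge⇒edge d anc-b)
      ρu≤v : root b u ≤ v
      ρu≤v = recF-sound p n v v d (bonsaiRoot-isRecord bv pv)
        (ℕ.<⇒≤ (anc-just⇒< p (p-forest v) anc-p)) anc-p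
      ρu≢v : root b u ≢ v
      ρu≢v ρu≡v =
        forest⇒acyclic p p-forest d v (subst (λ y → anc p (suc d) v ≡ just y) ρu≡v anc-p)

    admissible : ∀ v → Admissible v (lookup p v)
    admissible v with lookup b v in bv
    ... | just u = bonsaiEdge⇒edge bv
    ... | nothing with lookup p v in pv
    ...   | nothing = tt
    ...   | just u  = graft-below bv pv

  module Admissible⇒Forest (p : Parent n) (adm : ∀ v → Admissible v (lookup p v)) where

    bonsaiEdge⇒edge : ∀ {x y} → lookup b x ≡ just y → lookup p x ≡ just y
    bonsaiEdge⇒edge {x} bx = subst (λ c → AdmissibleFor c x (lookup p x)) bx (adm x)

    graft-below : ∀ {x y} → lookup b x ≡ nothing → lookup p x ≡ just y → root b y < x
    graft-below {x} bx px =
      subst (AdmissibleFor nothing x) px (subst (λ c → AdmissibleFor c x (lookup p x)) bx (adm x))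

    edge : ∀ {x y} → lookup p x ≡ just y → lookup b x ≡ just y ⊎ root b y < root b x
    edge {x} px with lookup b x in bx
    ... | just u  = inj₁ (trans (sym (bonsaiEdge⇒edge bx)) px)
    ... | nothing = inj₂ (subst (root b _ <_) (sym (root-of-root bx)) (graft-below bx px))

    path : ∀ k {x y} → anc p k x ≡ just y → anc b k x ≡ just y ⊎ root b y < root b x
    path zero refl = inj₁ refl
    path (suc k) {x} {y} a with lookup p x in px
    ... | nothing = contradiction a λ ()
    ... | just u with edge px | path k a
    ...   | inj₁ bx | inj₁ b-path = inj₁ (trans (anc-parent b bx) b-path)
    ...   | inj₁ bx | inj₂ lt     = inj₂ (subst (root b y <_) (sym (root-parent bx)) lt)
    ...   | inj₂ lt | inj₁ b-path = inj₂ (subst (_< root b x) (sym (root-anc k b-path)) lt)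
    ...   | inj₂ lt | inj₂ lt′    = inj₂ (ℕ.<-trans lt′ lt)

    root-antitone : ∀ k {x y} → anc p k x ≡ just y → root b y ≤ root b x
    root-antitone k a with path k a
    ... | inj₁ b-path = ℕ.≤-reflexive (cong toℕ (root-anc k b-path))
    ... | inj₂ lt     = ℕ.<⇒≤ lt

    acyclic : Acyclic p
    acyclic d x cycle with path (suc d) cycle
    ... | inj₁ b-cycle = forest⇒acyclic b b-forest d x b-cycle
    ... | inj₂ lt      = ℕ.<-irrefl refl lt

    bonsaiRoot-isRecord : ∀ {v} → lookup b v ≡ nothing → T (isRecord p v)
    bonsaiRoot-isRecord {v} bv = recF-complete p n v v above
      where
      above : ∀ j {x} → anc p (suc j) v ≡ just x → x ≤ v
      above j {x} a with lookup p v in pv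
      ... | nothing = contradiction a λ ()
      ... | just w  =
        ℕ.<⇒≤ (ℕ.≤-<-trans (ℕ.≤-trans (≤-root x) (root-antitone j a)) (graft-below bv pv))

    nonroot-¬isRecord : ∀ {v u} → lookup b v ≡ just u → ¬ T (isRecord p v)
    nonroot-¬isRecord {v} bv rec with rootF-ancestor b n v
    ... | zero , _ , a =
      root-≢-nonroot bv v (sym (just-injective a))
    ... | suc d , sd≤n , a =
      ℕ.<⇒≱ (nonroot-<-root bv)
        (recF-sound p n v v d rec sd≤n (anc-⊆ {q = b} {p} bonsaiEdge⇒edge (suc d) a))

    bonsaiSeq≡ : bonsaiSeq p ≡ b
    bonsaiSeq≡ = trans (tabulate-cong pointwise) (tabulate∘lookup b)
      where
      pointwise : ∀ v → (if isRecord p v then nothing else lookup p v) ≡ lookup b v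
      pointwise v with lookup b v in bv | isRecord p v in rec
      ... | nothing | true  = refl
      ... | nothing | false = ⊥-elim (subst T rec (bonsaiRoot-isRecord bv))
      ... | just u  | true  = ⊥-elim (nonroot-¬isRecord bv (subst T (sym rec) tt))
      ... | just u  | false = bonsaiEdge⇒edge bv

  forest-bonsaiSeq⇔admissible : ∀ p →
    (IsForest p × bonsaiSeq p ≡ b) ⇔ Pointwise Admissible (allFin n) p
  forest-bonsaiSeq⇔admissible p = mk⇔
    (λ (p-forest , p↦b) →
      Pointwise-tabulate⁺ p (Forest⇒Admissible.admissible p (All-tabulate⁻ p-forest) p↦b))
    (λ adm → let open Admissible⇒Forest p (Pointwise-tabulate⁻ {R = Admissible} {f = id} {as = p} adm) in
      All-tabulate⁺ (acyclic⇒forest p acyclic) , bonsaiSeq≡)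

  forests-↔-admissible :
    Σ (Parent n) (λ p → IsForest p × bonsaiSeq p ≡ b) ↔ Σ (Parent n) (Pointwise Admissible (allFin n))
  forests-↔-admissible =
    Σ-cong-⇔ forest-irrelevant (Pointwise-irrelevant admissible-irrelevant) forest-bonsaiSeq⇔admissible
    where
    forest-irrelevant : Irrelevant (λ p → IsForest p × bonsaiSeq p ≡ b)
    forest-irrelevant (forest , e) (forest′ , e′) = cong₂ _,_ (All.irrelevant uip forest forest′) (uip e e′)

  vertices : List (Fin n)
  vertices = toList (allFin n)

  below : ℕ → ℕ
  below m = length (filter (λ w → toℕ (root b w) ℕ.<? m) vertices)

  treeSize : Fin n → ℕ
  treeSize r = length (filter (λ w → root b w ≟ r) vertices)

  isRoot? : (v : Fin n) → Dec (is-nothing (lookup b v) ≡ true)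
  isRoot? v = is-nothing (lookup b v) Bool.≟ true

  parentChoicesFor : Maybe (Fin n) → Fin n → ℕ
  parentChoicesFor (just _) v = 1
  parentChoicesFor nothing  v = suc (below (toℕ v))

  parentChoices : Fin n → ℕ
  parentChoices v = parentChoicesFor (lookup b v) v

  admissibleFor-↔ : ∀ c v → Σ (Maybe (Fin n)) (AdmissibleFor c v) ↔ Fin (parentChoicesFor c v)
  admissibleFor-↔ (just u) v = Σ-singleton-↔ (just u)
  admissibleFor-↔ nothing  v = ↔-trans (Σ-Maybe-↔ _)
    (↔-trans (↔-sym 1↔⊤ ⊎-↔ Σ-↔-length-filter ℕ.<-irrelevant (λ w → toℕ (root b w) ℕ.<? toℕ v) id)
             (↔-sym +↔⊎))

  admissible-↔ :
    Σ (Parent n) (Pointwise Admissible (allFin n)) ↔ Fin (product (map parentChoices vertices))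
  admissible-↔ = Σ-Pointwise-↔ parentChoices (λ v → admissibleFor-↔ (lookup b v) v) (allFin n)

  below-zero : below 0 ≡ 0
  below-zero = cong length (filter-none _ (ListAll.universal (λ _ ()) vertices))

  below-suc : ∀ {r m} → toℕ r ≡ m → below (suc m) ≡ below m + treeSize r
  below-suc {r} {m} r≡m = length-filter-⊎ _ _ _ (mk⇔ split merge) disjoint vertices
    where
    split : ∀ {w} → toℕ (root b w) ℕ.< suc m → toℕ (root b w) ℕ.< m ⊎ root b w ≡ r
    split lt with ℕ.m<1+n⇒m<n∨m≡n lt
    ... | inj₁ lt′ = inj₁ lt′
    ... | inj₂ eq  = inj₂ (toℕ-injective (trans eq (sym r≡m)))
    merge : ∀ {w} → toℕ (root b w) ℕ.< m ⊎ root b w ≡ r → toℕ (root b w) ℕ.< suc m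
    merge (inj₁ lt) = ℕ.m<n⇒m<1+n lt
    merge (inj₂ eq) = ℕ.≤-reflexive (cong suc (trans (cong toℕ eq) r≡m))
    disjoint : ∀ {w} → toℕ (root b w) ℕ.< m → root b w ≢ r
    disjoint lt eq = ℕ.<-irrefl (trans (cong toℕ eq) r≡m) lt

  treeSize-nonroot : ∀ {r u} → lookup b r ≡ just u → treeSize r ≡ 0
  treeSize-nonroot br = cong length (filter-none _ (ListAll.universal (root-≢-nonroot br) vertices))

  below-suc-nonroot : ∀ {r u m} → toℕ r ≡ m → lookup b r ≡ just u → below (suc m) ≡ below m
  below-suc-nonroot {r} {m = m} r≡m br = begin
    below (suc m)         ≡⟨ below-suc r≡m ⟩
    below m + treeSize r  ≡⟨ cong (below m +_) (treeSize-nonroot br) ⟩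
    below m + 0           ≡⟨ ℕ.+-identityʳ _ ⟩
    below m               ∎

  -- Scanning the vertices m, m + 1, … the accumulator is the total size of the earlier bonsais.
  scan : ∀ {k} (f : Fin k → Fin n) m acc → acc ≡ below m → Consecutive m f →
    product (map parentChoices (toList (tabulate f)))
      ≡ prefixProduct′ acc (map treeSize (filter isRoot? (toList (tabulate f))))
  scan {zero}  f m acc acc≡ f-consecutive = refl
  scan {suc k} f m acc acc≡ f-consecutive with lookup b (f zero) in bv
  ... | nothing = cong₂ _*_
    (cong suc (trans (cong below (consecutive-head f-consecutive)) (sym acc≡)))
    (scan (f ∘ suc) (suc m) _ (trans (cong (_+ _) acc≡) (sym (below-suc (consecutive-head f-consecutive))))
          (consecutive-tail f-consecutive))
  ... | just u  = trans (ℕ.*-identityˡ _)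
    (scan (f ∘ suc) (suc m) acc (trans acc≡ (sym (below-suc-nonroot (consecutive-head f-consecutive) bv)))
          (consecutive-tail f-consecutive))

  product-parentChoices : product (map parentChoices vertices) ≡ typeProduct (bonsaiType b)
  product-parentChoices =
    trans (scan id 0 0 (sym below-zero) (λ _ → refl)) (sym (typeProduct≡prefixProduct′ (bonsaiType b)))

mainTheorem13 : (n : ℕ) (b : Parent n) → IsBonsaiSeq b →
    (Σ (Parent n) (λ p → IsForest p × bonsaiSeq p ≡ b)) ↔ Fin (typeProduct (bonsaiType b))
mainTheorem13 n b (b-forest , ≤-root , _) =
  subst (λ m → _ ↔ Fin m) product-parentChoices (↔-trans forests-↔-admissible admissible-↔)
  where open BonsaiForest b (All-tabulate⁻ b-forest) ≤-root
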